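{- Let $h \geq 2$, let $k_0 = \left\lfloor \frac{1}{2^{1/h}-1} \right\rfloor + 1$, and let $k_1 \geq k_0$ be an integer. Let $r_1 < r_2 < \cdots < r_h$ be pairwise relatively prime positive integers, and let $P$ be a positive integer such that $P \geq r_h - r_1$ and such that, whenever $1 \leq i < j \leq h$ and a prime $p$ divides $r_j - r_i$, $p$ divides $P$. For integers $k \geq 0$ define $s_{i,k} = kP + r_i$ ($i = 1,\ldots,h$), $S_k = \prod_{i=1}^h s_{i,k}$, and $a_{i,k} = S_k/s_{i,k} = \prod_{j\neq i} s_{j,k}$. For each positive integer $t$ let $\ell_t$ be the unique integer (with $\ell_t \ge -k_1$) such that $S_{k_1+\ell_t} \leq S_{k_1}^t < S_{k_1+\ell_t+1}$. For $t \geq 1$ let \[ V(t) = \left\{ a_{i,k_1+\ell_t}\, v : i \in \{1,\ldots,h\},\ v \in \mathbf{Z},\ 1 \leq v \leq \frac{(h-1)S_{k_1+\ell_{t+1}}}{a_{i,k_1+\ell_t}} \right\}. \] Then the set \[ \mathcal{A} = \{0,1,2,\ldots,(h-1)S_{k_1}\} \cup \bigcup_{t=1}^{\infty} V(t) \] is a thin basis of order $h$.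
   Context: $\lfloor \cdot \rfloor$ denotes the integer part. For a set $\mathcal{A}$ of nonnegative integers, $h\mathcal{A} = \{a_1 + \cdots + a_h : a_1,\ldots,a_h \in \mathcal{A}\}$ (not necessarily distinct summands). $\mathcal{A}$ is a basis of order $h$ if $h\mathcal{A}$ equals the set of all nonnegative integers. Its counting function is $A(x) = \#\{a \in \mathcal{A} : 1 \leq a \leq x\}$. A basis $\mathcal{A}$ of order $h$ is thin if $\limsup_{x\to\infty} A(x)/x^{1/h} < \infty$. -}

module Defs where

open import Data.Nat using (ℕ; zero; suc; _+_; _*_; _∸_; _^_; _≤_; _<_; _≡ᵇ_)
open import Data.Nat.Coprimality using (Coprime)
open import Data.Nat.Divisibility using (_∣_)
open import Data.Nat.Primality using (Prime)
open import Data.Bool using (if_then_else_)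
open import Data.Product using (Σ; ∃; ∃-syntax; _×_)
open import Data.Sum using (_⊎_)
open import Data.List using (List; length)
open import Data.List.Relation.Unary.All using () renaming (All to AllL)
open import Data.List.Relation.Unary.Unique.Propositional using (Unique)
open import Data.Vec using (Vec; sum)
open import Data.Vec.Relation.Unary.All using (All)
open import Relation.Binary.PropositionalEquality using (_≡_)

prodTo : ℕ → (ℕ → ℕ) → ℕ
prodTo zero    f = 1
prodTo (suc n) f = prodTo n f * f (suc n)

s : (P : ℕ) (r : ℕ → ℕ) (i k : ℕ) → ℕ
s P r i k = k * P + r i

S : (h P : ℕ) (r : ℕ → ℕ) (k : ℕ) → ℕ
S h P r k = prodTo h (λ i → s P r i k)

a : (h P : ℕ) (r : ℕ → ℕ) (i k : ℕ) → ℕ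
a h P r i k = prodTo h (λ j → if j ≡ᵇ i then 1 else s P r j k)

-- Membership in 𝒜 = {0,…,(h-1)S_{k₁}} ∪ ⋃_{t ≥ 1} V(t),
-- where m t = k₁ + ℓ_t  (a natural number, since ℓ_t ≥ -k₁).
-- The condition v ≤ (h-1) S_{k₁+ℓ_{t+1}} / a_{i,k₁+ℓ_t} (real division, a > 0)
-- is written as a_{i,k₁+ℓ_t} * v ≤ (h-1) S_{k₁+ℓ_{t+1}}.
InA : (h P : ℕ) (r : ℕ → ℕ) (k₁ : ℕ) (m : ℕ → ℕ) → ℕ → Set
InA h P r k₁ m x =
  x ≤ (h ∸ 1) * S h P r k₁
  ⊎ ∃[ t ] ∃[ i ] ∃[ v ]
      (1 ≤ t × 1 ≤ i × i ≤ h × 1 ≤ v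
       × a h P r i (m t) * v ≤ (h ∸ 1) * S h P r (m (suc t))
       × x ≡ a h P r i (m t) * v)

IsBasisOfOrder : ℕ → (ℕ → Set) → Set
IsBasisOfOrder h A = ∀ (n : ℕ) → ∃[ xs ] (All A {h} xs × sum xs ≡ n)

-- Thin: limsup A(x)/x^{1/h} < ∞, i.e. ∃ C x₀ with A(x)^h ≤ C x for x ≥ x₀.
-- "A(x) ^ h ≤ C x" is expressed as: every duplicate-free list of elements
-- of 𝒜 ∩ [1,x] has length L with L ^ h ≤ C x.
Thin : ℕ → (ℕ → Set) → Set
Thin h A = ∃[ C ] ∃[ x₀ ] ∀ (x : ℕ) → x₀ ≤ x → ∀ (L : List ℕ) → Unique L →
  AllL (λ y → 1 ≤ y × y ≤ x × A y) L → length L ^ h ≤ C * x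

{-# OPTIONS --safe #-}
module Submission where

-- The moduli s_{i,k} = kP + r_i are pairwise coprime: a common prime factor would divide
-- r_j − r_i, hence P, hence r_i and r_j. So if (h−1) S_k ≤ n one can solve
-- a_{i,k} v_i ≡ n (mod s_{i,k}) with v_i < s_{i,k} for every i < h; the remainder
-- n − Σ_{i<h} a_{i,k} v_i ≥ 0 is then divisible by s_{1,k} ⋯ s_{h−1,k} = a_{h,k}, which supplies the
-- last summand. With k = k₁ + ℓ_t and (h−1) S_{k₁+ℓ_t} ≤ n ≤ (h−1) S_{k₁+ℓ_{t+1}} all summands lie in V(t).
--
-- For thinness, s_{i,k} ≤ 2 s_{j,k} and S_{k+1} ≤ 2^h S_k give S_{k₁}^{t(h−1)} ≤ W a_{i,k₁+ℓ_t}^h for a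
-- constant W. If S_{k₁}^u ≤ x < S_{k₁}^{u+1}, the number of multiples of a_{i,k₁+ℓ_t} in V(t) ∩ [1, x]
-- is then at most a constant times (x / 2^d)^{1/h}, where d is the distance from t to u; summing
-- these geometrically decaying counts over t and i gives A(x) = O(x^{1/h}).

open import Defs
open import Data.Nat using (ℕ; suc; _+_; _*_; _∸_; _^_; _≤_; _<_)
open import Data.Nat.Coprimality using (Coprime)
open import Data.Nat.Divisibility using (_∣_)
open import Data.Nat.Primality using (Prime)
open import Data.Product using (_×_)

open import Data.Bool using (true; false; if_then_else_)
open import Data.Empty using (⊥; ⊥-elim)
open import Data.List using (List; []; _∷_; length; _++_)
open import Data.List.Properties using (length-++)
open import Data.List.Relation.Unary.Any.Properties using (++⁺ˡ; ++⁺ʳ)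
open import Data.List.Membership.Propositional using (_∈_)
open import Data.List.Relation.Unary.All using (All; _∷_; lookup)
open import Data.List.Relation.Unary.AllPairs using (_∷_)
open import Data.List.Relation.Unary.Any using (here; there)
open import Data.List.Relation.Unary.Unique.Propositional using (Unique)
open import Data.Nat using (zero; _≡ᵇ_; _⊓_; z≤n; s≤s; _≤?_; _≟_; _/_; _%_; NonZero; >-nonZero)
open import Data.Nat.Coprimality using (coprime-divisor; coprime-Bézout)
import Data.Nat.Coprimality as Coprimality
open import Data.Nat.DivMod using (m≡m%n+[m/n]*n; m%n<n; m/n*n≤m; m*n/n≡m; /-monoˡ-≤)
open import Data.Nat.Divisibility
  using (divides; quotient; ∣m⇒∣m*n; n∣m*n; ∣-trans; ∣1⇒≡1; ∣m∣n⇒∣m+n; 0∣⇒≡0; ∣m+n∣m⇒∣n; ∣n⇒∣m*n; m∣m*n)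
open import Data.Nat.GCD using (module Bézout)
open import Data.Nat.Induction using (<-rec)
open import Data.Nat.ListAction using (product)
open import Data.Nat.Primality using (¬prime[1])
open import Data.Nat.Primality.Factorisation using (factorise)
open import Data.Nat.Properties
open import Data.Nat.Tactic.RingSolver using (solve-∀)
open import Data.Product using (_,_; proj₁; proj₂; ∃-syntax)
open import Data.Sum using (_⊎_; inj₁; inj₂)
open import Data.Vec using (Vec; []; _∷_) renaming (sum to sumᵥ)
open import Data.Vec.Relation.Unary.All using () renaming (All to Allᵥ; [] to []ᵥ; _∷_ to _∷ᵥ_)
open import Relation.Binary.PropositionalEquality
open import Relation.Binary.Definitions using (tri<; tri≈; tri>)
open import Relation.Nullary using (Dec; yes; no; contradiction)
open import Function using (_∘_)


Upto : ℕ → (ℕ → Set) → Set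
Upto n P = ∀ j → 1 ≤ j → j ≤ n → P j

module _ {P : ℕ → Set} {n : ℕ} where

  Upto-init : Upto (suc n) P → Upto n P
  Upto-init p j 1≤j j≤n = p j 1≤j (m≤n⇒m≤1+n j≤n)

  Upto-last : Upto (suc n) P → P (suc n)
  Upto-last p = p (suc n) (s≤s z≤n) ≤-refl

Upto-choice : ∀ n {R : ℕ → ℕ → Set} → Upto n (λ i → ∃[ v ] R i v) → ∃[ v ] Upto n (λ i → R i (v i))
Upto-choice n {R} solvable = v , spec
  where
  v : ℕ → ℕ
  v i with 1 ≤? i | i ≤? n
  ... | yes 1≤i | yes i≤n = proj₁ (solvable i 1≤i i≤n)
  ... | _       | _       = 0
  spec : Upto n (λ i → R i (v i))
  spec i 1≤i i≤n with 1 ≤? i | i ≤? n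
  ... | yes 1≤i′ | yes i≤n′ = proj₂ (solvable i 1≤i′ i≤n′)
  ... | no  1≰i  | _        = contradiction 1≤i 1≰i
  ... | yes _    | no  i≰n  = contradiction i≤n i≰n

^-distribʳ-* : ∀ a b n → (a * b) ^ n ≡ a ^ n * b ^ n
^-distribʳ-* a b zero    = refl
^-distribʳ-* a b (suc n) = trans (cong (a * b *_) (^-distribʳ-* a b n)) (regroup a b (a ^ n) (b ^ n))
  where
  regroup : ∀ a b x y → a * b * (x * y) ≡ a * x * (b * y)
  regroup = solve-∀

^-cancelʳ-≤ : ∀ n {a b} → a ^ suc n ≤ b ^ suc n → a ≤ b
^-cancelʳ-≤ n {a} {b} aⁿ≤bⁿ with a ≤? b
... | yes a≤b = a≤b
... | no  a≰b = contradiction aⁿ≤bⁿ (<⇒≱ (^-monoˡ-< (suc n) (≰⇒> a≰b)))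

^-positive : ∀ {a} n → 1 ≤ a → 1 ≤ a ^ n
^-positive zero    _   = s≤s z≤n
^-positive (suc n) 1≤a = *-mono-≤ 1≤a (^-positive n 1≤a)

m≤m^[1+n] : ∀ {m} n → 1 ≤ m → m ≤ m ^ suc n
m≤m^[1+n] {m} n 1≤m = subst (_≤ m * m ^ n) (*-identityʳ m) (*-monoʳ-≤ m (^-positive n 1≤m))

m≤m*n⁺ : ∀ m {n} → 1 ≤ n → m ≤ m * n
m≤m*n⁺ m {suc n} _ = m≤m*n m (suc n)

n<2^n : ∀ n → n < 2 ^ n
n<2^n zero    = s≤s z≤n
n<2^n (suc n) = +-mono-<-≤ (^-positive n (s≤s z≤n)) (subst (n <_) (sym (+-identityʳ (2 ^ n))) (n<2^n n))

bracket : ∀ (f : ℕ → ℕ) {x} N → f 0 ≤ x → x < f N → ∃[ u ] (f u ≤ x × x < f (suc u))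
bracket f zero    f0≤x x<f0 = contradiction f0≤x (<⇒≱ x<f0)
bracket f {x} (suc N) f0≤x x<fN with f N ≤? x
... | yes fN≤x = N , fN≤x , x<fN
... | no  fN≰x = bracket f N f0≤x (≰⇒> fN≰x)

sumTo : ℕ → (ℕ → ℕ) → ℕ
sumTo zero    f = 0
sumTo (suc n) f = sumTo n f + f (suc n)

sumTo-zero : ∀ n → sumTo n (λ _ → 0) ≡ 0
sumTo-zero zero    = refl
sumTo-zero (suc n) = cong (_+ 0) (sumTo-zero n)

sumTo-cong : ∀ n {f g} → Upto n (λ j → f j ≡ g j) → sumTo n f ≡ sumTo n g
sumTo-cong zero    _   = refl
sumTo-cong (suc n) f≗g = cong₂ _+_ (sumTo-cong n (Upto-init f≗g)) (Upto-last f≗g)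

sumTo-≤-* : ∀ n B {f} → Upto n (λ j → f j ≤ B) → sumTo n f ≤ n * B
sumTo-≤-* zero    B _   = z≤n
sumTo-≤-* (suc n) B f≤B = begin
  sumTo n _ + _  ≤⟨ +-mono-≤ (sumTo-≤-* n B (Upto-init f≤B)) (Upto-last f≤B) ⟩
  n * B + B      ≡⟨ +-comm (n * B) B ⟩
  suc n * B      ∎
  where open ≤-Reasoning

term≤sumTo : ∀ n f {i} → 1 ≤ i → i ≤ n → f i ≤ sumTo n f
term≤sumTo zero    f 1≤i i≤0 = contradiction (≤-trans 1≤i i≤0) λ ()
term≤sumTo (suc n) f {i} 1≤i i≤n with i ≟ suc n
... | yes refl = m≤n+m (f (suc n)) (sumTo n f)
... | no  i≢n  = ≤-trans (term≤sumTo n f 1≤i (≤-pred (≤∧≢⇒< i≤n i≢n))) (m≤m+n _ _)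

*-distribˡ-sumTo : ∀ k n f → k * sumTo n f ≡ sumTo n (λ i → k * f i)
*-distribˡ-sumTo k zero    f = *-zeroʳ k
*-distribˡ-sumTo k (suc n) f =
  trans (*-distribˡ-+ k (sumTo n f) (f (suc n))) (cong (_+ k * f (suc n)) (*-distribˡ-sumTo k n f))

sumTo-head : ∀ n f → sumTo (suc n) f ≡ f 1 + sumTo n (λ e → f (suc e))
sumTo-head zero    f = +-comm 0 (f 1)
sumTo-head (suc n) f = trans (cong (_+ f (2 + n)) (sumTo-head n f)) (+-assoc (f 1) _ _)

sumTo-split : ∀ m n f → sumTo (m + n) f ≡ sumTo m f + sumTo n (λ e → f (m + e))
sumTo-split m zero    f = trans (cong (λ k → sumTo k f) (+-identityʳ m)) (sym (+-identityʳ _))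
sumTo-split m (suc n) f = begin
  sumTo (m + suc n) f                                    ≡⟨ cong (λ k → sumTo k f) (+-suc m n) ⟩
  sumTo (m + n) f + f (suc (m + n))                      ≡⟨ cong₂ _+_ (sumTo-split m n f) (cong f (sym (+-suc m n))) ⟩
  sumTo m f + sumTo n (λ e → f (m + e)) + f (m + suc n)  ≡⟨ +-assoc (sumTo m f) _ _ ⟩
  sumTo m f + sumTo (suc n) (λ e → f (m + e))            ∎
  where open ≡-Reasoning

sumTo-monoˡ-≤ : ∀ {m n} f → m ≤ n → sumTo m f ≤ sumTo n f
sumTo-monoˡ-≤ {m} f m≤n with m≤n⇒∃[o]m+o≡n m≤n
... | o , refl = subst (sumTo m f ≤_) (sym (sumTo-split m o f)) (m≤m+n _ _)

sumTo-reverse : ∀ n f → sumTo n f ≡ sumTo n (λ e → f (suc n ∸ e))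
sumTo-reverse zero    f = refl
sumTo-reverse (suc n) f = begin
  sumTo n f + f (suc n)                              ≡⟨ cong (_+ f (suc n)) (sumTo-reverse n f) ⟩
  sumTo n (λ e → f (suc n ∸ e)) + f (suc n)          ≡⟨ +-comm _ (f (suc n)) ⟩
  f (suc n) + sumTo n (λ e → f (suc n ∸ e))          ≡⟨ sym (sumTo-head n (λ e → f (2 + n ∸ e))) ⟩
  sumTo (suc n) (λ e → f (2 + n ∸ e))                ∎
  where open ≡-Reasoning

∣-sumTo : ∀ n {g d} → Upto n (λ i → d ∣ g i) → d ∣ sumTo n g
∣-sumTo zero    _   = divides 0 refl
∣-sumTo (suc n) d∣g = ∣m∣n⇒∣m+n (∣-sumTo n (Upto-init d∣g)) (Upto-last d∣g)

sumTo-isolate : ∀ n g {d j} → 1 ≤ j → j ≤ n → (∀ i → 1 ≤ i → i ≤ n → i ≢ j → d ∣ g i) →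
  ∃[ R ] (d ∣ R × sumTo n g ≡ g j + R)
sumTo-isolate zero    g 1≤j j≤0 _ = contradiction (≤-trans 1≤j j≤0) λ ()
sumTo-isolate (suc n) g {d} {j} 1≤j j≤n d∣others with j ≟ suc n
... | yes refl = sumTo n g , ∣-sumTo n (λ i 1≤i i≤n → d∣others i 1≤i (m≤n⇒m≤1+n i≤n) (<⇒≢ (s≤s i≤n))) ,
                 +-comm (sumTo n g) (g j)
... | no j≢n with sumTo-isolate n g 1≤j (≤-pred (≤∧≢⇒< j≤n j≢n)) (λ i 1≤i i≤n → d∣others i 1≤i (m≤n⇒m≤1+n i≤n))
... | R , d∣R , eq = R + g (suc n) , ∣m∣n⇒∣m+n d∣R (d∣others (suc n) (s≤s z≤n) ≤-refl (j≢n ∘ sym)) ,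
                     trans (cong (_+ g (suc n)) eq) (+-assoc (g j) R (g (suc n)))

HalvesEvery : ℕ → ℕ → ℕ → (ℕ → ℕ) → Set
HalvesEvery H B n f = ∀ d j → j * H ≤ d → suc d ≤ n → 2 ^ j * f (suc d) ≤ B

HalvesEvery-bounded : ∀ {H B n} f → HalvesEvery H B n f → Upto n (λ j → f j ≤ B)
HalvesEvery-bounded {B = B} f halves (suc d) _ d<n = subst (_≤ B) (*-identityˡ _) (halves d 0 z≤n d<n)

HalvesEvery-shift : ∀ {H B n} f → HalvesEvery H B (H + n) f → HalvesEvery H B n (λ e → 2 * f (H + e))
HalvesEvery-shift {H} {B} {n} f halves d j jH≤d d<n = subst (_≤ B) reshape
  (halves (H + d) (suc j) (+-monoʳ-≤ H jH≤d) (subst (_≤ H + n) (+-suc H d) (+-monoʳ-≤ H d<n)))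
  where
  swap : ∀ p x → 2 * p * x ≡ p * (2 * x)
  swap = solve-∀
  reshape : 2 ^ suc j * f (suc (H + d)) ≡ 2 ^ j * (2 * f (H + suc d))
  reshape = trans (cong (λ e → 2 ^ suc j * f e) (sym (+-suc H d))) (swap (2 ^ j) _)

sumTo-halving : ∀ {H B} n f → 1 ≤ H → HalvesEvery H B n f → sumTo n f ≤ 2 * H * B
sumTo-halving {H} {B} n f 1≤H = <-rec Goal step n f
  where
  Goal : ℕ → Set
  Goal n = ∀ f → HalvesEvery H B n f → sumTo n f ≤ 2 * H * B

  step : ∀ n → (∀ {m} → m < n → Goal m) → Goal n
  step n rec f halves with H ≤? n
  ... | no H≰n = begin
    sumTo n f  ≤⟨ sumTo-≤-* n B (HalvesEvery-bounded f halves) ⟩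
    n * B      ≤⟨ *-monoˡ-≤ B (≤-trans (<⇒≤ (≰⇒> H≰n)) (m≤n*m H 2)) ⟩
    2 * H * B  ∎
    where open ≤-Reasoning
  ... | yes H≤n with m≤n⇒∃[o]m+o≡n H≤n
  ... | n′ , refl = begin
    sumTo (H + n′) f                           ≡⟨ sumTo-split H n′ f ⟩
    sumTo H f + sumTo n′ (λ e → f (H + e))     ≤⟨ +-mono-≤ (sumTo-≤-* H B head) tail ⟩
    H * B + H * B                              ≡⟨ double H B ⟩
    2 * H * B                                  ∎
    where
    open ≤-Reasoning
    double : ∀ H B → H * B + H * B ≡ 2 * H * B
    double = solve-∀
    head : Upto H (λ j → f j ≤ B)
    head j 1≤j j≤H = HalvesEvery-bounded f halves j 1≤j (≤-trans j≤H (m≤m+n H n′))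
    tail : sumTo n′ (λ e → f (H + e)) ≤ H * B
    tail = *-cancelˡ-≤ 2 (begin
      2 * sumTo n′ (λ e → f (H + e))         ≡⟨ *-distribˡ-sumTo 2 n′ (λ e → f (H + e)) ⟩
      sumTo n′ (λ e → 2 * f (H + e))         ≤⟨ rec (m<n+m n′ 1≤H) (λ e → 2 * f (H + e)) (HalvesEvery-shift f halves) ⟩
      2 * H * B                              ≡⟨ *-assoc 2 H B ⟩
      2 * (H * B)                            ∎)

prodTo-cong : ∀ n {f g} → Upto n (λ j → f j ≡ g j) → prodTo n f ≡ prodTo n g
prodTo-cong zero    _   = refl
prodTo-cong (suc n) f≗g = cong₂ _*_ (prodTo-cong n (Upto-init f≗g)) (Upto-last f≗g)

prodTo-mono-≤ : ∀ n {f g} → Upto n (λ j → f j ≤ g j) → prodTo n f ≤ prodTo n g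
prodTo-mono-≤ zero    _   = ≤-refl
prodTo-mono-≤ (suc n) f≤g = *-mono-≤ (prodTo-mono-≤ n (Upto-init f≤g)) (Upto-last f≤g)

prodTo-const : ∀ n c → prodTo n (λ _ → c) ≡ c ^ n
prodTo-const zero    c = refl
prodTo-const (suc n) c = trans (cong (_* c) (prodTo-const n c)) (*-comm (c ^ n) c)

prodTo-pos : ∀ n {f} → Upto n (λ j → 1 ≤ f j) → 1 ≤ prodTo n f
prodTo-pos n {f} 1≤f = subst (_≤ prodTo n f) (trans (prodTo-const n 1) (^-zeroˡ n)) (prodTo-mono-≤ n 1≤f)

prodTo-*ˡ : ∀ n c f → prodTo n (λ j → c * f j) ≡ c ^ n * prodTo n f
prodTo-*ˡ zero    c f = refl
prodTo-*ˡ (suc n) c f =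
  trans (cong (_* (c * f (suc n))) (prodTo-*ˡ n c f)) (regroup (c ^ n) (prodTo n f) c (f (suc n)))
  where
  regroup : ∀ p q c x → p * q * (c * x) ≡ c * p * (q * x)
  regroup = solve-∀

≡ᵇ-refl : ∀ n → (n ≡ᵇ n) ≡ true
≡ᵇ-refl zero    = refl
≡ᵇ-refl (suc n) = ≡ᵇ-refl n

≢⇒≡ᵇ-false : ∀ m n → m ≢ n → (m ≡ᵇ n) ≡ false
≢⇒≡ᵇ-false zero    zero    m≢n = contradiction refl m≢n
≢⇒≡ᵇ-false zero    (suc n) _   = refl
≢⇒≡ᵇ-false (suc m) zero    _   = refl
≢⇒≡ᵇ-false (suc m) (suc n) m≢n = ≢⇒≡ᵇ-false m n (m≢n ∘ cong suc)

-- a h P r i k is definitionally prodTo h (except i (λ j → s P r j k)).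
except : ℕ → (ℕ → ℕ) → ℕ → ℕ
except i f j = if j ≡ᵇ i then 1 else f j

except-self : ∀ i f → except i f i ≡ 1
except-self i f rewrite ≡ᵇ-refl i = refl

except-other : ∀ {i j} f → j ≢ i → except i f j ≡ f j
except-other {i} {j} f j≢i rewrite ≢⇒≡ᵇ-false j i j≢i = refl

prodTo-except-beyond : ∀ n {i} f → n < i → prodTo n (except i f) ≡ prodTo n f
prodTo-except-beyond n f n<i = prodTo-cong n (λ j _ j≤n → except-other f (<⇒≢ (≤-<-trans j≤n n<i)))

prodTo-except-* : ∀ n {i} f → 1 ≤ i → i ≤ n → prodTo n (except i f) * f i ≡ prodTo n f
prodTo-except-* zero    f 1≤i i≤0 = contradiction (≤-trans 1≤i i≤0) λ ()
prodTo-except-* (suc n) {i} f 1≤i i≤n with i ≟ suc n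
... | yes refl = begin
  prodTo n (except i f) * except i f i * f i   ≡⟨ cong₂ (λ p e → p * e * f i) (prodTo-except-beyond n f ≤-refl) (except-self i f) ⟩
  prodTo n f * 1 * f i                         ≡⟨ cong (_* f i) (*-identityʳ (prodTo n f)) ⟩
  prodTo n f * f i                             ∎
  where open ≡-Reasoning
... | no i≢n = begin
  prodTo n (except i f) * except i f (suc n) * f i   ≡⟨ cong (λ e → prodTo n (except i f) * e * f i) (except-other f (i≢n ∘ sym)) ⟩
  prodTo n (except i f) * f (suc n) * f i            ≡⟨ swap (prodTo n (except i f)) (f (suc n)) (f i) ⟩
  prodTo n (except i f) * f i * f (suc n)            ≡⟨ cong (_* f (suc n)) (prodTo-except-* n f 1≤i (≤-pred (≤∧≢⇒< i≤n i≢n))) ⟩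
  prodTo n f * f (suc n)                             ∎
  where
  open ≡-Reasoning
  swap : ∀ p x y → p * x * y ≡ p * y * x
  swap = solve-∀

∣-prodTo : ∀ n f {j} → 1 ≤ j → j ≤ n → f j ∣ prodTo n f
∣-prodTo zero    f 1≤j j≤0 = contradiction (≤-trans 1≤j j≤0) λ ()
∣-prodTo (suc n) f {j} 1≤j j≤n with j ≟ suc n
... | yes refl = n∣m*n (prodTo n f)
... | no  j≢n  = ∣m⇒∣m*n (f (suc n)) (∣-prodTo n f 1≤j (≤-pred (≤∧≢⇒< j≤n j≢n)))

∣-prodTo-except : ∀ n {i j} f → 1 ≤ j → j ≤ n → j ≢ i → f j ∣ prodTo n (except i f)
∣-prodTo-except n f 1≤j j≤n j≢i = subst (_∣ _) (except-other f j≢i) (∣-prodTo n (except _ f) 1≤j j≤n)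

coprime-*ʳ : ∀ {a b c} → Coprime a b → Coprime a c → Coprime a (b * c)
coprime-*ʳ a⊥b a⊥c (d∣a , d∣bc) = a⊥c (d∣a , coprime-divisor (λ (e∣d , e∣b) → a⊥b (∣-trans e∣d d∣a , e∣b)) d∣bc)

coprime-prodTo : ∀ n c {f} → Upto n (λ j → Coprime c (f j)) → Coprime c (prodTo n f)
coprime-prodTo zero    c _   (_ , d∣1) = ∣1⇒≡1 d∣1
coprime-prodTo (suc n) c c⊥f = coprime-*ʳ (coprime-prodTo n c (Upto-init c⊥f)) (Upto-last c⊥f)

prodTo-∣ : ∀ n {f D} → (∀ i j → 1 ≤ i → i < j → j ≤ n → Coprime (f i) (f j)) →
  Upto n (λ j → f j ∣ D) → prodTo n f ∣ D
prodTo-∣ zero    {D = D} _ _ = divides D (sym (*-identityʳ D))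
prodTo-∣ (suc n) {f} {D} pairwise f∣D =
  extend (prodTo-∣ n (λ i j 1≤i i<j j≤n → pairwise i j 1≤i i<j (m≤n⇒m≤1+n j≤n)) (Upto-init f∣D))
  where
  last⊥Π : Coprime (f (suc n)) (prodTo n f)
  last⊥Π = coprime-prodTo n _ (λ j 1≤j j≤n → Coprimality.sym (pairwise j (suc n) 1≤j (s≤s j≤n) ≤-refl))
  regroup : ∀ a b c → a * b * c ≡ a * (c * b)
  regroup = solve-∀
  extend : prodTo n f ∣ D → prodTo (suc n) f ∣ D
  extend (divides q D≡q*Π)
    with coprime-divisor last⊥Π (subst (f (suc n) ∣_) (trans D≡q*Π (*-comm q _)) (Upto-last f∣D))
  ... | divides q′ q≡q′*last = divides q′ (begin
    D                               ≡⟨ D≡q*Π ⟩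
    q * prodTo n f                  ≡⟨ cong (_* prodTo n f) q≡q′*last ⟩
    q′ * f (suc n) * prodTo n f     ≡⟨ regroup q′ (f (suc n)) (prodTo n f) ⟩
    q′ * (prodTo n f * f (suc n))   ∎)
    where open ≡-Reasoning

prime-divisor : ∀ d → 2 ≤ d → ∃[ p ] (Prime p × p ∣ d)
prime-divisor (suc zero) (s≤s ())
prime-divisor d@(suc (suc _)) _ with factorise d
... | record { factors = [] ; isFactorisation = () }
... | record { factors = p ∷ ps ; isFactorisation = d≡Π ; factorsPrime = p-prime ∷ _ } =
  p , p-prime , divides (product ps) (trans d≡Π (*-comm p (product ps)))

no-common-prime⇒coprime : ∀ {m n} → 1 ≤ m → (∀ {p} → Prime p → p ∣ m → p ∣ n → ⊥) → Coprime m n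
no-common-prime⇒coprime {m} 1≤m no-prime {zero}          (0∣m , _)   = contradiction (0∣⇒≡0 0∣m) (>⇒≢ 1≤m)
no-common-prime⇒coprime {m} 1≤m no-prime {suc zero}      _           = refl
no-common-prime⇒coprime {m} 1≤m no-prime {d@(suc (suc _))} (d∣m , d∣n) with prime-divisor d (s≤s (s≤s z≤n))
... | p , p-prime , p∣d = ⊥-elim (no-prime p-prime (∣-trans p∣d d∣m) (∣-trans p∣d d∣n))

-- Solutions of a v ≡ n (mod s), written without subtraction.
CongruenceSolution : ℕ → ℕ → ℕ → ℕ → Set
CongruenceSolution a s n v = ∃[ Y ] ∃[ Z ] (a * v + s * Y ≡ n + s * Z)

congruence-solvable : ∀ {a s} n → 1 ≤ s → Coprime a s → ∃[ w ] CongruenceSolution a s n w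
congruence-solvable {a} {s} n _ a⊥s with coprime-Bézout a⊥s
congruence-solvable {a} {s} n _ a⊥s | Bézout.+- x y 1+ys≡xa = n * x , 0 , n * y , (begin
  a * (n * x) + s * 0   ≡⟨ regroup a n x s ⟩
  n * (x * a)           ≡⟨ cong (n *_) (sym 1+ys≡xa) ⟩
  n * (1 + y * s)       ≡⟨ expand n y s ⟩
  n + s * (n * y)       ∎)
  where
  open ≡-Reasoning
  regroup : ∀ a n x s → a * (n * x) + s * 0 ≡ n * (x * a)
  regroup = solve-∀
  expand : ∀ n y s → n * (1 + y * s) ≡ n + s * (n * y)
  expand = solve-∀
congruence-solvable {a} {suc s₀} n _ a⊥s | Bézout.-+ x y 1+xa≡ys = n * x * s₀ , n , n * y * s₀ , (begin
  a * (n * x * s₀) + suc s₀ * n    ≡⟨ regroup a n x s₀ ⟩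
  n * s₀ * (1 + x * a) + n         ≡⟨ cong (λ e → n * s₀ * e + n) 1+xa≡ys ⟩
  n * s₀ * (y * suc s₀) + n        ≡⟨ expand n y s₀ ⟩
  n + suc s₀ * (n * y * s₀)        ∎)
  where
  open ≡-Reasoning
  regroup : ∀ a n x s₀ → a * (n * x * s₀) + suc s₀ * n ≡ n * s₀ * (1 + x * a) + n
  regroup = solve-∀
  expand : ∀ n y s₀ → n * s₀ * (y * suc s₀) + n ≡ n + suc s₀ * (n * y * s₀)
  expand = solve-∀

congruence-reduce : ∀ {a s n w} .{{_ : NonZero s}} → CongruenceSolution a s n w →
  CongruenceSolution a s n (w % s)
congruence-reduce {a} {s} {n} {w} (Y , Z , eq) = a * (w / s) + Y , Z , (begin
  a * (w % s) + s * (a * (w / s) + Y)   ≡⟨ regroup a (w % s) (w / s) s Y ⟩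
  a * (w % s + w / s * s) + s * Y       ≡⟨ cong (λ e → a * e + s * Y) (sym (m≡m%n+[m/n]*n w s)) ⟩
  a * w + s * Y                         ≡⟨ eq ⟩
  n + s * Z                             ∎)
  where
  open ≡-Reasoning
  regroup : ∀ a v q s Y → a * v + s * (a * q + Y) ≡ a * (v + q * s) + s * Y
  regroup = solve-∀

linear-congruence : ∀ {a s} n → 1 ≤ s → Coprime a s → ∃[ v ] (v < s × CongruenceSolution a s n v)
linear-congruence {a} {s@(suc _)} n 1≤s a⊥s with congruence-solvable n 1≤s a⊥s
... | w , sol = w % s , m%n<n w s , congruence-reduce {a} {s} {n} sol

vecTo : ∀ n → (ℕ → ℕ) → Vec ℕ n
vecTo zero    g = []
vecTo (suc n) g = g (suc n) ∷ vecTo n g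

sum-vecTo : ∀ n g → sumᵥ (vecTo n g) ≡ sumTo n g
sum-vecTo zero    g = refl
sum-vecTo (suc n) g = trans (cong (g (suc n) +_) (sum-vecTo n g)) (+-comm (g (suc n)) (sumTo n g))

All-vecTo : ∀ {A : ℕ → Set} n g → Upto n (λ i → A (g i)) → Allᵥ A (vecTo n g)
All-vecTo zero    g _  = []ᵥ
All-vecTo (suc n) g Ag = Upto-last Ag ∷ᵥ All-vecTo n g (Upto-init Ag)

multiples : ℕ → ℕ → List ℕ
multiples a zero    = []
multiples a (suc c) = a * suc c ∷ multiples a c

length-multiples : ∀ a c → length (multiples a c) ≡ c
length-multiples a zero    = refl
length-multiples a (suc c) = cong suc (length-multiples a c)

∈-multiples : ∀ a c {v} → 1 ≤ v → v ≤ c → a * v ∈ multiples a c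
∈-multiples a zero    1≤v v≤0 = contradiction (≤-trans 1≤v v≤0) λ ()
∈-multiples a (suc c) {v} 1≤v v≤c with v ≟ suc c
... | yes refl = here refl
... | no  v≢c  = there (∈-multiples a c 1≤v (≤-pred (≤∧≢⇒< v≤c v≢c)))

concatTo : ℕ → (ℕ → List ℕ) → List ℕ
concatTo zero    f = []
concatTo (suc n) f = concatTo n f ++ f (suc n)

length-concatTo : ∀ n f → length (concatTo n f) ≡ sumTo n (λ i → length (f i))
length-concatTo zero    f = refl
length-concatTo (suc n) f = trans (length-++ (concatTo n f)) (cong (_+ length (f (suc n))) (length-concatTo n f))

∈-concatTo : ∀ n f {i y} → 1 ≤ i → i ≤ n → y ∈ f i → y ∈ concatTo n f
∈-concatTo zero    f 1≤i i≤0 _ = contradiction (≤-trans 1≤i i≤0) λ ()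
∈-concatTo (suc n) f {i} 1≤i i≤n y∈fi with i ≟ suc n
... | yes refl = ++⁺ʳ (concatTo n f) y∈fi
... | no  i≢n  = ++⁺ˡ (∈-concatTo n f 1≤i (≤-pred (≤∧≢⇒< i≤n i≢n)) y∈fi)

remove : ℕ → List ℕ → List ℕ
remove y []       = []
remove y (z ∷ zs) with y ≟ z
... | yes _ = zs
... | no  _ = z ∷ remove y zs

length-remove : ∀ {y} zs → y ∈ zs → suc (length (remove y zs)) ≡ length zs
length-remove {y} (z ∷ zs) y∈zs with y ≟ z
length-remove {y} (z ∷ zs) _           | yes _   = refl
length-remove {y} (z ∷ zs) (here y≡z)  | no  y≢z = contradiction y≡z y≢z
length-remove {y} (z ∷ zs) (there y∈zs) | no  _  = cong suc (length-remove zs y∈zs)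

∈-remove : ∀ {y w} zs → w ∈ zs → w ≢ y → w ∈ remove y zs
∈-remove {y} (z ∷ zs) w∈zs w≢y with y ≟ z
∈-remove {y} (z ∷ zs) (here refl)  w≢y | yes refl = contradiction refl w≢y
∈-remove {y} (z ∷ zs) (there w∈zs) w≢y | yes _    = w∈zs
∈-remove {y} (z ∷ zs) (here w≡z)   w≢y | no  _    = here w≡z
∈-remove {y} (z ∷ zs) (there w∈zs) w≢y | no  _    = there (∈-remove zs w∈zs w≢y)

Unique-⊆⇒length-≤ : ∀ xs ys → Unique xs → (∀ {y} → y ∈ xs → y ∈ ys) → length xs ≤ length ys
Unique-⊆⇒length-≤ []       ys _            _  = z≤n
Unique-⊆⇒length-≤ (x ∷ xs) ys (x∉xs ∷ uxs) xs⊆ys =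
  subst (suc (length xs) ≤_) (length-remove ys (xs⊆ys (here refl)))
    (s≤s (Unique-⊆⇒length-≤ xs (remove x ys) uxs (λ w∈xs → ∈-remove ys (xs⊆ys (there w∈xs)) (distinct x∉xs w∈xs))))
  where
  distinct : ∀ {w zs} → All (x ≢_) zs → w ∈ zs → w ≢ x
  distinct (x≢z ∷ _)    (here refl)  w≡x = x≢z (sym w≡x)
  distinct (_ ∷ x≢zs) (there w∈zs) w≡x = distinct x≢zs w∈zs w≡x

-- The moduli s, S and a

module Moduli (h₀ P : ℕ) (r : ℕ → ℕ)
  (r-pos : ∀ i → 1 ≤ i → i ≤ 2 + h₀ → 1 ≤ r i)
  (r-increasing : ∀ i j → 1 ≤ i → i < j → j ≤ 2 + h₀ → r i < r j)
  (r-coprime : ∀ i j → 1 ≤ i → i < j → j ≤ 2 + h₀ → Coprime (r i) (r j))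
  (P-pos : 1 ≤ P) (P-spread : r (2 + h₀) ∸ r 1 ≤ P)
  (P-primes : ∀ i j p → 1 ≤ i → i < j → j ≤ 2 + h₀ → Prime p → p ∣ (r j ∸ r i) → p ∣ P)
  where

  h h-1 : ℕ
  h   = 2 + h₀
  h-1 = 1 + h₀

  s′ : ℕ → ℕ → ℕ
  s′ = s P r

  S′ : ℕ → ℕ
  S′ = S h P r

  a′ : ℕ → ℕ → ℕ
  a′ = a h P r

  r-mono-≤ : ∀ {i j} → 1 ≤ i → i ≤ j → j ≤ h → r i ≤ r j
  r-mono-≤ {i} {j} 1≤i i≤j j≤h with i ≟ j
  ... | yes refl = ≤-refl
  ... | no  i≢j  = <⇒≤ (r-increasing i j 1≤i (≤∧≢⇒< i≤j i≢j) j≤h)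

  s-pos : ∀ k i → 1 ≤ i → i ≤ h → 1 ≤ s′ i k
  s-pos k i 1≤i i≤h = ≤-trans (r-pos i 1≤i i≤h) (m≤n+m (r i) (k * P))

  P≤kP : ∀ {k} → 1 ≤ k → P ≤ k * P
  P≤kP {suc _} _ = m≤m+n P _

  s-≤-2*s : ∀ {i j k} → 1 ≤ k → 1 ≤ i → i ≤ h → 1 ≤ j → j ≤ h → s′ i k ≤ 2 * s′ j k
  s-≤-2*s {i} {j} {k} 1≤k 1≤i i≤h 1≤j j≤h = begin
    k * P + r i                  ≤⟨ +-monoʳ-≤ (k * P) (r-mono-≤ 1≤i i≤h ≤-refl) ⟩
    k * P + r h                  ≤⟨ +-monoʳ-≤ (k * P) r[h]≤P+r[j] ⟩
    k * P + (P + r j)            ≤⟨ +-monoʳ-≤ (k * P) (+-monoˡ-≤ (r j) (P≤kP 1≤k)) ⟩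
    k * P + (k * P + r j)        ≤⟨ m≤m+n _ (r j) ⟩
    k * P + (k * P + r j) + r j  ≡⟨ double (k * P) (r j) ⟩
    2 * (k * P + r j)            ∎
    where
    open ≤-Reasoning
    r[h]≤P+r[j] : r h ≤ P + r j
    r[h]≤P+r[j] = begin
      r h                 ≡⟨ m∸n+n≡m (r-mono-≤ (s≤s z≤n) (s≤s z≤n) ≤-refl) ⟨
      r h ∸ r 1 + r 1     ≤⟨ +-mono-≤ P-spread (r-mono-≤ (s≤s z≤n) 1≤j j≤h) ⟩
      P + r j             ∎
    double : ∀ x y → x + (x + y) + y ≡ 2 * (x + y)
    double = solve-∀

  s-suc-≤ : ∀ j {k} → 1 ≤ k → s′ j (suc k) ≤ 2 * s′ j k
  s-suc-≤ j {k} 1≤k = begin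
    P + k * P + r j             ≤⟨ +-monoˡ-≤ (r j) (+-monoˡ-≤ (k * P) (P≤kP 1≤k)) ⟩
    k * P + k * P + r j         ≤⟨ m≤m+n _ (r j) ⟩
    k * P + k * P + r j + r j   ≡⟨ double (k * P) (r j) ⟩
    2 * (k * P + r j)           ∎
    where
    open ≤-Reasoning
    double : ∀ x y → x + x + y + y ≡ 2 * (x + y)
    double = solve-∀

  S-suc-≤ : ∀ {k} → 1 ≤ k → S′ (suc k) ≤ 2 ^ h * S′ k
  S-suc-≤ {k} 1≤k = ≤-trans (prodTo-mono-≤ h (λ j _ _ → s-suc-≤ j 1≤k)) (≤-reflexive (prodTo-*ˡ h 2 (λ j → s′ j k)))

  S-mono-≤ : ∀ {k k′} → k ≤ k′ → S′ k ≤ S′ k′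
  S-mono-≤ k≤k′ = prodTo-mono-≤ h (λ j _ _ → +-monoˡ-≤ (r j) (*-monoˡ-≤ P k≤k′))

  S-≥2 : ∀ {k} → 1 ≤ k → 2 ≤ S′ k
  S-≥2 {k} 1≤k = *-mono-≤ (prodTo-pos h-1 (Upto-init (s-pos k)))
                          (+-mono-≤ (≤-trans P-pos (P≤kP 1≤k)) (r-pos h (s≤s z≤n) ≤-refl))

  a*s≡S : ∀ {i} k → 1 ≤ i → i ≤ h → a′ i k * s′ i k ≡ S′ k
  a*s≡S k = prodTo-except-* h (λ j → s′ j k)

  a-pos : ∀ i k → 1 ≤ a′ i k
  a-pos i k = prodTo-pos h factor-pos
    where
    factor-pos : Upto h (λ j → 1 ≤ except i (λ j → s′ j k) j)
    factor-pos j 1≤j j≤h with j ≟ i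
    ... | yes refl = ≤-reflexive (sym (except-self j (λ j → s′ j k)))
    ... | no  j≢i  = subst (1 ≤_) (sym (except-other (λ j → s′ j k) j≢i)) (s-pos k j 1≤j j≤h)

  a[h]≡prodTo : ∀ k → a′ h k ≡ prodTo h-1 (λ j → s′ j k)
  a[h]≡prodTo k = begin
    prodTo h-1 (except h sₖ) * except h sₖ h   ≡⟨ cong (prodTo h-1 (except h sₖ) *_) (except-self h sₖ) ⟩
    prodTo h-1 (except h sₖ) * 1               ≡⟨ *-identityʳ _ ⟩
    prodTo h-1 (except h sₖ)                   ≡⟨ prodTo-except-beyond h-1 sₖ ≤-refl ⟩
    prodTo h-1 sₖ                              ∎
    where
    open ≡-Reasoning
    sₖ : ℕ → ℕ
    sₖ j = s′ j k

  S^[h-1]≤2^h*a^h : ∀ {i k} → 1 ≤ k → 1 ≤ i → i ≤ h → S′ k ^ h-1 ≤ 2 ^ h * a′ i k ^ h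
  S^[h-1]≤2^h*a^h {i} {k} 1≤k 1≤i i≤h =
    *-cancelʳ-≤ (S′ k ^ h-1) (2 ^ h * a′ i k ^ h) (s′ i k ^ h) {{>-nonZero (^-positive h (s-pos k i 1≤i i≤h))}} (begin
      S′ k ^ h-1 * s′ i k ^ h                 ≤⟨ *-monoʳ-≤ (S′ k ^ h-1) sᵢ^h≤2^h*S ⟩
      S′ k ^ h-1 * (2 ^ h * S′ k)             ≡⟨ regroup (S′ k ^ h-1) (2 ^ h) (S′ k) ⟩
      2 ^ h * S′ k ^ h                        ≡⟨ cong (λ e → 2 ^ h * e ^ h) (a*s≡S k 1≤i i≤h) ⟨
      2 ^ h * (a′ i k * s′ i k) ^ h           ≡⟨ cong (2 ^ h *_) (^-distribʳ-* (a′ i k) (s′ i k) h) ⟩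
      2 ^ h * (a′ i k ^ h * s′ i k ^ h)       ≡⟨ *-assoc (2 ^ h) _ _ ⟨
      2 ^ h * a′ i k ^ h * s′ i k ^ h         ∎)
    where
    open ≤-Reasoning
    sᵢ^h≤2^h*S : s′ i k ^ h ≤ 2 ^ h * S′ k
    sᵢ^h≤2^h*S = begin
      s′ i k ^ h                  ≡⟨ prodTo-const h (s′ i k) ⟨
      prodTo h (λ _ → s′ i k)     ≤⟨ prodTo-mono-≤ h (λ j 1≤j j≤h → s-≤-2*s 1≤k 1≤i i≤h 1≤j j≤h) ⟩
      prodTo h (λ j → 2 * s′ j k) ≡⟨ prodTo-*ˡ h 2 (λ j → s′ j k) ⟩
      2 ^ h * S′ k                ∎
    regroup : ∀ x y z → x * (y * z) ≡ y * (z * x)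
    regroup = solve-∀

  s-coprime : ∀ k i j → 1 ≤ i → i < j → j ≤ h → Coprime (s′ i k) (s′ j k)
  s-coprime k i j 1≤i i<j j≤h = no-common-prime⇒coprime (s-pos k i 1≤i (≤-trans (<⇒≤ i<j) j≤h)) common-prime
    where
    common-prime : ∀ {p} → Prime p → p ∣ s′ i k → p ∣ s′ j k → ⊥
    common-prime {p} p-prime p∣sᵢ p∣sⱼ = ¬prime[1] (subst Prime (r-coprime i j 1≤i i<j j≤h (p∣rᵢ , p∣rⱼ)) p-prime)
      where
      sⱼ≡sᵢ+[rⱼ∸rᵢ] : s′ j k ≡ s′ i k + (r j ∸ r i)
      sⱼ≡sᵢ+[rⱼ∸rᵢ] = trans (cong (k * P +_) (sym (m+[n∸m]≡n (<⇒≤ (r-increasing i j 1≤i i<j j≤h)))))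
                            (sym (+-assoc (k * P) (r i) _))
      p∣kP : p ∣ k * P
      p∣kP = ∣n⇒∣m*n k (P-primes i j p 1≤i i<j j≤h p-prime (∣m+n∣m⇒∣n (subst (p ∣_) sⱼ≡sᵢ+[rⱼ∸rᵢ] p∣sⱼ) p∣sᵢ))
      p∣rᵢ : p ∣ r i
      p∣rᵢ = ∣m+n∣m⇒∣n p∣sᵢ p∣kP
      p∣rⱼ : p ∣ r j
      p∣rⱼ = ∣m+n∣m⇒∣n p∣sⱼ p∣kP

  s-coprime-≢ : ∀ k {i j} → 1 ≤ i → i ≤ h → 1 ≤ j → j ≤ h → i ≢ j → Coprime (s′ i k) (s′ j k)
  s-coprime-≢ k {i} {j} 1≤i i≤h 1≤j j≤h i≢j with <-cmp i j
  ... | tri< i<j _ _ = s-coprime k i j 1≤i i<j j≤h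
  ... | tri≈ _ i≡j _ = contradiction i≡j i≢j
  ... | tri> _ _ j<i = Coprimality.sym (s-coprime k j i 1≤j j<i i≤h)

  a-coprime-s : ∀ {i} k → 1 ≤ i → i ≤ h → Coprime (a′ i k) (s′ i k)
  a-coprime-s {i} k 1≤i i≤h = Coprimality.sym (coprime-prodTo h (s′ i k) coprime-factor)
    where
    coprime-factor : Upto h (λ j → Coprime (s′ i k) (except i (λ j → s′ j k) j))
    coprime-factor j 1≤j j≤h with j ≟ i
    ... | yes refl = subst (Coprime (s′ j k)) (sym (except-self j (λ j → s′ j k))) (Coprimality.sym (Coprimality.1-coprimeTo _))
    ... | no  j≢i  = subst (Coprime (s′ i k)) (sym (except-other (λ j → s′ j k) j≢i)) (s-coprime-≢ k 1≤i i≤h 1≤j j≤h (j≢i ∘ sym))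

  representation : ∀ k n → h-1 * S′ k ≤ n →
    ∃[ v ] ∃[ q ] (a′ h k * q + sumTo h-1 (λ i → a′ i k * v i) ≡ n)
  representation k n n-large = v , q , (begin
    a′ h k * q + Σ  ≡⟨ cong (_+ Σ) (trans (*-comm (a′ h k) q) (sym D≡q*a)) ⟩
    D + Σ           ≡⟨ +-comm D Σ ⟩
    Σ + D           ≡⟨ Σ+D≡n ⟩
    n               ∎)
    where
    open ≡-Reasoning
    residues : Upto h-1 (λ i → ∃[ v ] (v < s′ i k × CongruenceSolution (a′ i k) (s′ i k) n v))
    residues i 1≤i i≤h-1 = linear-congruence n (s-pos k i 1≤i (m≤n⇒m≤1+n i≤h-1)) (a-coprime-s k 1≤i (m≤n⇒m≤1+n i≤h-1))

    v : ℕ → ℕ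
    v = proj₁ (Upto-choice h-1 residues)

    v-spec : Upto h-1 (λ i → v i < s′ i k × CongruenceSolution (a′ i k) (s′ i k) n (v i))
    v-spec = proj₂ (Upto-choice h-1 residues)

    Σ D : ℕ
    Σ = sumTo h-1 (λ i → a′ i k * v i)
    D = n ∸ Σ

    Σ+D≡n : Σ + D ≡ n
    Σ+D≡n = m+[n∸m]≡n (≤-trans Σ≤ n-large)
      where
      Σ≤ : Σ ≤ h-1 * S′ k
      Σ≤ = sumTo-≤-* h-1 (S′ k) λ i 1≤i i≤h-1 →
        ≤-trans (*-monoʳ-≤ (a′ i k) (<⇒≤ (proj₁ (v-spec i 1≤i i≤h-1)))) (≤-reflexive (a*s≡S k 1≤i (m≤n⇒m≤1+n i≤h-1)))

    sⱼ∣D : Upto h-1 (λ j → s′ j k ∣ D)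
    sⱼ∣D j 1≤j j≤h-1
      with sumTo-isolate h-1 (λ i → a′ i k * v i) 1≤j j≤h-1
             (λ i _ _ i≢j → ∣m⇒∣m*n (v i) (∣-prodTo-except h (λ j → s′ j k) 1≤j (m≤n⇒m≤1+n j≤h-1) (i≢j ∘ sym)))
         | proj₂ (v-spec j 1≤j j≤h-1)
    ... | R , sⱼ∣R , Σ≡aⱼvⱼ+R | Y , Z , congruence =
      ∣m+n∣m⇒∣n (subst (s′ j k ∣_) sⱼY≡ (m∣m*n Y)) (∣m∣n⇒∣m+n sⱼ∣R (m∣m*n Z))
      where
      sⱼY≡ : s′ j k * Y ≡ R + s′ j k * Z + D
      sⱼY≡ = +-cancelˡ-≡ (a′ j k * v j) _ _ (begin
        a′ j k * v j + s′ j k * Y                 ≡⟨ congruence ⟩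
        n + s′ j k * Z                            ≡⟨ cong (_+ s′ j k * Z) (sym Σ+D≡n) ⟩
        Σ + D + s′ j k * Z                        ≡⟨ cong (λ e → e + D + s′ j k * Z) Σ≡aⱼvⱼ+R ⟩
        a′ j k * v j + R + D + s′ j k * Z         ≡⟨ regroup (a′ j k * v j) R D (s′ j k * Z) ⟩
        a′ j k * v j + (R + s′ j k * Z + D)       ∎)
        where
        regroup : ∀ x R D W → x + R + D + W ≡ x + (R + W + D)
        regroup = solve-∀

    a[h]∣D : a′ h k ∣ D
    a[h]∣D = subst (_∣ D) (sym (a[h]≡prodTo k))
      (prodTo-∣ h-1 (λ i j 1≤i i<j j≤h-1 → s-coprime k i j 1≤i i<j (m≤n⇒m≤1+n j≤h-1)) sⱼ∣D)

    q : ℕ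
    q = quotient a[h]∣D

    D≡q*a : D ≡ q * a′ h k
    D≡q*a = _∣_.equality a[h]∣D

  module Sequence (k₁ : ℕ) (1≤k₁ : 1 ≤ k₁) (m : ℕ → ℕ)
    (m-spec : ∀ t → 1 ≤ t → S′ (m t) ≤ S′ k₁ ^ t × S′ k₁ ^ t < S′ (suc (m t)))
    where

    Q : ℕ
    Q = S′ k₁

    𝒜 : ℕ → Set
    𝒜 = InA h P r k₁ m

    Q≥2 : 2 ≤ Q
    Q≥2 = S-≥2 1≤k₁

    Q≥1 : 1 ≤ Q
    Q≥1 = ≤-trans (s≤s z≤n) Q≥2

    m-pos : ∀ t → 1 ≤ t → 1 ≤ m t
    m-pos t@(suc t′) 1≤t with m t | proj₂ (m-spec t 1≤t)
    ... | suc _ | _          = s≤s z≤n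
    ... | zero  | Qᵗ<S[1] = contradiction (≤-trans (S-mono-≤ 1≤k₁) (m≤m^[1+n] t′ Q≥1)) (<⇒≱ Qᵗ<S[1])

    Q^t≤2^h*S[m[t]] : ∀ t → 1 ≤ t → Q ^ t ≤ 2 ^ h * S′ (m t)
    Q^t≤2^h*S[m[t]] t 1≤t = ≤-trans (<⇒≤ (proj₂ (m-spec t 1≤t))) (S-suc-≤ (m-pos t 1≤t))

    2^t≤S[m[h+t]] : ∀ t → 2 ^ t ≤ S′ (m (h + t))
    2^t≤S[m[h+t]] t = *-cancelˡ-≤ (2 ^ h) {{m^n≢0 2 h}} (begin
      2 ^ h * 2 ^ t         ≡⟨ ^-distribˡ-+-* 2 h t ⟨
      2 ^ (h + t)           ≤⟨ ^-monoˡ-≤ (h + t) Q≥2 ⟩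
      Q ^ (h + t)           ≤⟨ Q^t≤2^h*S[m[t]] (h + t) (s≤s z≤n) ⟩
      2 ^ h * S′ (m (h + t)) ∎)
      where open ≤-Reasoning

    -- The basis property

    multiple-∈𝒜 : ∀ {t i} → 1 ≤ t → 1 ≤ i → i ≤ h →
      ∀ v → a′ i (m t) * v ≤ h-1 * S′ (m (suc t)) → 𝒜 (a′ i (m t) * v)
    multiple-∈𝒜 {t} {i} _   _   _   zero    _     = inj₁ (subst (_≤ h-1 * Q) (sym (*-zeroʳ (a′ i (m t)))) z≤n)
    multiple-∈𝒜 {t} {i} 1≤t 1≤i i≤h (suc v) bound = inj₂ (t , i , suc v , 1≤t , 1≤i , i≤h , s≤s z≤n , bound , refl)

    sum-in-segment : ∀ t → 1 ≤ t → ∀ n → h-1 * S′ (m t) ≤ n → n ≤ h-1 * S′ (m (suc t)) →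
      ∃[ xs ] (Allᵥ 𝒜 {h} xs × sumᵥ xs ≡ n)
    sum-in-segment t 1≤t n lower upper = sum-of (representation (m t) n lower)
      where
      sum-of : ∃[ v ] ∃[ q ] (a′ h (m t) * q + sumTo h-1 (λ i → a′ i (m t) * v i) ≡ n) →
        ∃[ xs ] (Allᵥ 𝒜 {h} xs × sumᵥ xs ≡ n)
      sum-of (v , q , a[h]q+Σ≡n) = a′ h (m t) * q ∷ vecTo h-1 g , last ∷ᵥ All-vecTo h-1 g others ,
        trans (cong (a′ h (m t) * q +_) (sum-vecTo h-1 g)) a[h]q+Σ≡n
        where
        g : ℕ → ℕ
        g i = a′ i (m t) * v i
        last : 𝒜 (a′ h (m t) * q)
        last = multiple-∈𝒜 1≤t (s≤s z≤n) ≤-refl q (≤-trans (≤-trans (m≤m+n _ (sumTo h-1 g)) (≤-reflexive a[h]q+Σ≡n)) upper)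
        others : Upto h-1 (λ i → 𝒜 (g i))
        others i 1≤i i≤h-1 = multiple-∈𝒜 1≤t 1≤i (m≤n⇒m≤1+n i≤h-1) (v i)
          (≤-trans (≤-trans (term≤sumTo h-1 g 1≤i i≤h-1) (≤-trans (m≤n+m _ (a′ h (m t) * q)) (≤-reflexive a[h]q+Σ≡n))) upper)

    segment : ∀ n → h-1 * Q < n → ∃[ t ] (1 ≤ t × h-1 * S′ (m t) ≤ n × n ≤ h-1 * S′ (m (suc t)))
    segment n n-large with bracket (λ u → h-1 * S′ (m (suc u))) (h-1 + n) lowest highest
      where
      lowest : h-1 * S′ (m 1) ≤ n
      lowest = ≤-trans (*-monoʳ-≤ h-1 (≤-trans (proj₁ (m-spec 1 (s≤s z≤n))) (≤-reflexive (*-identityʳ Q)))) (<⇒≤ n-large)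
      highest : n < h-1 * S′ (m (h + n))
      highest = <-≤-trans (n<2^n n) (≤-trans (2^t≤S[m[h+t]] n) (m≤n*m _ h-1))
    ... | u , lower , upper = suc u , s≤s z≤n , lower , <⇒≤ upper

    basis : IsBasisOfOrder h 𝒜
    basis n = by-size (n ≤? h-1 * Q)
      where
      Representation : Set
      Representation = ∃[ xs ] (Allᵥ 𝒜 {h} xs × sumᵥ xs ≡ n)
      in-segment : ∃[ t ] (1 ≤ t × h-1 * S′ (m t) ≤ n × n ≤ h-1 * S′ (m (suc t))) → Representation
      in-segment (t , 1≤t , lower , upper) = sum-in-segment t 1≤t n lower upper
      by-size : Dec (n ≤ h-1 * Q) → Representation
      by-size (yes small) = n ∷ vecTo h-1 (λ _ → 0) , inj₁ small ∷ᵥ All-vecTo h-1 (λ _ → 0) (λ _ _ _ → inj₁ z≤n) ,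
                            trans (cong (n +_) (trans (sum-vecTo h-1 (λ _ → 0)) (sumTo-zero h-1))) (+-identityʳ n)
      by-size (no large)  = in-segment (segment n (≰⇒> large))

    -- Thinness

    W K : ℕ
    W = (2 ^ h) ^ h-1 * 2 ^ h
    K = W * h-1 ^ h * Q ^ h

    W≤K : W ≤ K
    W≤K = ≤-trans (m≤m*n⁺ W (^-positive h (s≤s z≤n))) (m≤m*n⁺ (W * h-1 ^ h) (^-positive h Q≥1))

    K≥1 : 1 ≤ K
    K≥1 = ≤-trans (*-mono-≤ (^-positive h-1 (^-positive h (s≤s z≤n))) (^-positive h (s≤s z≤n))) W≤K

    [Q^t]^[h-1]≤W*a^h : ∀ {t i} → 1 ≤ t → 1 ≤ i → i ≤ h → (Q ^ t) ^ h-1 ≤ W * a′ i (m t) ^ h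
    [Q^t]^[h-1]≤W*a^h {t} {i} 1≤t 1≤i i≤h = begin
      (Q ^ t) ^ h-1                           ≤⟨ ^-monoˡ-≤ h-1 (Q^t≤2^h*S[m[t]] t 1≤t) ⟩
      (2 ^ h * S′ (m t)) ^ h-1                ≡⟨ ^-distribʳ-* (2 ^ h) (S′ (m t)) h-1 ⟩
      (2 ^ h) ^ h-1 * S′ (m t) ^ h-1          ≤⟨ *-monoʳ-≤ ((2 ^ h) ^ h-1) (S^[h-1]≤2^h*a^h (m-pos t 1≤t) 1≤i i≤h) ⟩
      (2 ^ h) ^ h-1 * (2 ^ h * a′ i (m t) ^ h) ≡⟨ *-assoc ((2 ^ h) ^ h-1) (2 ^ h) _ ⟨
      W * a′ i (m t) ^ h                      ∎
      where open ≤-Reasoning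

    t≤W*a^h : ∀ {t i} → 1 ≤ t → 1 ≤ i → i ≤ h → t ≤ W * a′ i (m t) ^ h
    t≤W*a^h {t} 1≤t 1≤i i≤h = begin
      t              ≤⟨ <⇒≤ (n<2^n t) ⟩
      2 ^ t          ≤⟨ ^-monoˡ-≤ t Q≥2 ⟩
      Q ^ t          ≤⟨ m≤m^[1+n] h₀ (^-positive t Q≥1) ⟩
      (Q ^ t) ^ h-1  ≤⟨ [Q^t]^[h-1]≤W*a^h 1≤t 1≤i i≤h ⟩
      W * _          ∎
      where open ≤-Reasoning

    E : ℕ
    E = h-1 * Q + 4 * (h * (h * K))

    module Counting (x : ℕ) (1≤x : 1 ≤ x) where

      bound : ℕ → ℕ
      bound t = x ⊓ (h-1 * S′ (m (suc t)))

      count : ℕ → ℕ → ℕ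
      count t i = (bound t / a′ i (m t)) {{>-nonZero (a-pos i (m t))}}

      count*a≤bound : ∀ t i → count t i * a′ i (m t) ≤ bound t
      count*a≤bound t i = m/n*n≤m (bound t) (a′ i (m t)) {{>-nonZero (a-pos i (m t))}}

      ≤-count : ∀ {t i v} → a′ i (m t) * v ≤ bound t → v ≤ count t i
      ≤-count {t} {i} {v} av≤bound = subst (_≤ count t i) (m*n/n≡m v (a′ i (m t)) {{>-nonZero (a-pos i (m t))}})
        (/-monoˡ-≤ (a′ i (m t)) {{>-nonZero (a-pos i (m t))}} (subst (_≤ bound t) (*-comm (a′ i (m t)) v) av≤bound))

      root : ∃[ w ] (suc w ^ h ≤ x × x < suc (suc w) ^ h)
      root = bracket (λ w → suc w ^ h) x (≤-trans (≤-reflexive (^-zeroˡ h)) 1≤x) (<-≤-trans (n<1+n x) (m≤m^[1+n] h-1 (s≤s z≤n)))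

      Z : ℕ
      Z = suc (proj₁ root)

      Z^h≤x : Z ^ h ≤ x
      Z^h≤x = proj₁ (proj₂ root)

      x<[1+Z]^h : x < suc Z ^ h
      x<[1+Z]^h = proj₂ (proj₂ root)

      logarithm : ∃[ u ] (Q ^ u ≤ x × x < Q ^ suc u)
      logarithm = bracket (Q ^_) x 1≤x (<-≤-trans (n<2^n x) (^-monoˡ-≤ x Q≥2))

      u : ℕ
      u = proj₁ logarithm

      Q^u≤x : Q ^ u ≤ x
      Q^u≤x = proj₁ (proj₂ logarithm)

      x<Q^[1+u] : x < Q ^ suc u
      x<Q^[1+u] = proj₂ (proj₂ logarithm)

      count^h*[Q^t]^[h-1]≤W*bound^h : ∀ {t i} → 1 ≤ t → 1 ≤ i → i ≤ h →
        count t i ^ h * (Q ^ t) ^ h-1 ≤ W * bound t ^ h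
      count^h*[Q^t]^[h-1]≤W*bound^h {t} {i} 1≤t 1≤i i≤h = begin
        count t i ^ h * (Q ^ t) ^ h-1            ≤⟨ *-monoʳ-≤ (count t i ^ h) ([Q^t]^[h-1]≤W*a^h 1≤t 1≤i i≤h) ⟩
        count t i ^ h * (W * a′ i (m t) ^ h)     ≡⟨ swap (count t i ^ h) W (a′ i (m t) ^ h) ⟩
        W * (count t i ^ h * a′ i (m t) ^ h)     ≡⟨ cong (W *_) (^-distribʳ-* (count t i) (a′ i (m t)) h) ⟨
        W * (count t i * a′ i (m t)) ^ h         ≤⟨ *-monoʳ-≤ W (^-monoˡ-≤ h (count*a≤bound t i)) ⟩
        W * bound t ^ h                          ∎
        where
        open ≤-Reasoning
        swap : ∀ a b c → a * (b * c) ≡ b * (a * c)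
        swap = solve-∀

      count-below : ∀ {t i d} → 1 ≤ t → 1 ≤ i → i ≤ h → t + d ≡ u → count t i ^ h * 2 ^ d ≤ K * suc Z ^ h
      count-below {t} {i} {d} 1≤t 1≤i i≤h t+d≡u = begin
        count t i ^ h * 2 ^ d       ≤⟨ *-monoʳ-≤ (count t i ^ h) (^-monoˡ-≤ d Q≥2) ⟩
        count t i ^ h * Q ^ d       ≤⟨ *-monoˡ-≤ (Q ^ d) count^h≤K*Q^t ⟩
        K * Q ^ t * Q ^ d           ≡⟨ trans (*-assoc K (Q ^ t) (Q ^ d)) (cong (K *_) (trans (sym (^-distribˡ-+-* Q t d)) (cong (Q ^_) t+d≡u))) ⟩
        K * Q ^ u                   ≤⟨ *-monoʳ-≤ K (≤-trans Q^u≤x (<⇒≤ x<[1+Z]^h)) ⟩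
        K * suc Z ^ h               ∎
        where
        open ≤-Reasoning
        bound≤ : bound t ≤ h-1 * (Q * Q ^ t)
        bound≤ = ≤-trans (m⊓n≤n x (h-1 * S′ (m (suc t)))) (*-monoʳ-≤ h-1 (proj₁ (m-spec (suc t) (s≤s z≤n))))
        regroup : ∀ w a b x y → w * (a * (b * (x * y))) ≡ w * a * b * x * y
        regroup = solve-∀
        count^h≤K*Q^t : count t i ^ h ≤ K * Q ^ t
        count^h≤K*Q^t = *-cancelʳ-≤ _ _ ((Q ^ t) ^ h-1) {{>-nonZero (^-positive h-1 (^-positive t Q≥1))}} (begin
          count t i ^ h * (Q ^ t) ^ h-1                      ≤⟨ count^h*[Q^t]^[h-1]≤W*bound^h 1≤t 1≤i i≤h ⟩
          W * bound t ^ h                                    ≤⟨ *-monoʳ-≤ W (^-monoˡ-≤ h bound≤) ⟩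
          W * (h-1 * (Q * Q ^ t)) ^ h                        ≡⟨ cong (W *_) (trans (^-distribʳ-* h-1 (Q * Q ^ t) h) (cong (h-1 ^ h *_) (^-distribʳ-* Q (Q ^ t) h))) ⟩
          W * (h-1 ^ h * (Q ^ h * (Q ^ t * (Q ^ t) ^ h-1)))  ≡⟨ regroup W (h-1 ^ h) (Q ^ h) (Q ^ t) ((Q ^ t) ^ h-1) ⟩
          K * Q ^ t * (Q ^ t) ^ h-1                          ∎)

      count-above : ∀ {t i d} → 1 ≤ t → 1 ≤ i → i ≤ h → t ≡ suc (u + d) → count t i ^ h * 2 ^ d ≤ K * suc Z ^ h
      count-above {t} {i} {d} 1≤t 1≤i i≤h t≡1+u+d = begin
        count t i ^ h * 2 ^ d               ≤⟨ *-monoʳ-≤ (count t i ^ h) (^-monoˡ-≤ d Q≥2) ⟩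
        count t i ^ h * Q ^ d               ≤⟨ *-monoʳ-≤ (count t i ^ h) (m≤m^[1+n] h₀ (^-positive d Q≥1)) ⟩
        count t i ^ h * (Q ^ d) ^ h-1       ≤⟨ count^h*[Q^d]^[h-1]≤W*x ⟩
        W * x                               ≤⟨ *-mono-≤ W≤K (<⇒≤ x<[1+Z]^h) ⟩
        K * suc Z ^ h                       ∎
        where
        open ≤-Reasoning
        Y : ℕ
        Y = (Q ^ suc u) ^ h-1
        [Q^t]^[h-1]≡ : (Q ^ t) ^ h-1 ≡ (Q ^ d) ^ h-1 * Y
        [Q^t]^[h-1]≡ = begin-equality
          (Q ^ t) ^ h-1                 ≡⟨ cong (λ e → (Q ^ e) ^ h-1) t≡1+u+d ⟩
          (Q ^ (suc u + d)) ^ h-1       ≡⟨ cong (_^ h-1) (^-distribˡ-+-* Q (suc u) d) ⟩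
          (Q ^ suc u * Q ^ d) ^ h-1     ≡⟨ ^-distribʳ-* (Q ^ suc u) (Q ^ d) h-1 ⟩
          Y * (Q ^ d) ^ h-1             ≡⟨ *-comm Y _ ⟩
          (Q ^ d) ^ h-1 * Y             ∎
        count^h*[Q^d]^[h-1]≤W*x : count t i ^ h * (Q ^ d) ^ h-1 ≤ W * x
        count^h*[Q^d]^[h-1]≤W*x = *-cancelʳ-≤ _ _ Y {{>-nonZero (^-positive h-1 (^-positive (suc u) Q≥1))}} (begin
          count t i ^ h * (Q ^ d) ^ h-1 * Y    ≡⟨ trans (*-assoc (count t i ^ h) _ Y) (cong (count t i ^ h *_) (sym [Q^t]^[h-1]≡)) ⟩
          count t i ^ h * (Q ^ t) ^ h-1        ≤⟨ count^h*[Q^t]^[h-1]≤W*bound^h 1≤t 1≤i i≤h ⟩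
          W * bound t ^ h                      ≤⟨ *-monoʳ-≤ W (^-monoˡ-≤ h (m⊓n≤m x (h-1 * S′ (m (suc t))))) ⟩
          W * (x * x ^ h-1)                    ≤⟨ *-monoʳ-≤ W (*-monoʳ-≤ x (^-monoˡ-≤ h-1 (<⇒≤ x<Q^[1+u]))) ⟩
          W * (x * Y)                          ≡⟨ *-assoc W x Y ⟨
          W * x * Y                            ∎)

      Offset : ℕ → ℕ → Set
      Offset t d = t + d ≡ u ⊎ t ≡ suc (u + d)

      count-decay : ∀ {t i d} j → 1 ≤ t → 1 ≤ i → i ≤ h → Offset t d → j * h ≤ d → 2 ^ j * count t i ≤ K * suc Z
      count-decay {t} {i} {d} j 1≤t 1≤i i≤h offset jh≤d = ^-cancelʳ-≤ h-1 (begin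
        (2 ^ j * count t i) ^ h      ≡⟨ ^-distribʳ-* (2 ^ j) (count t i) h ⟩
        (2 ^ j) ^ h * count t i ^ h  ≡⟨ cong (_* count t i ^ h) (^-*-assoc 2 j h) ⟩
        2 ^ (j * h) * count t i ^ h  ≤⟨ *-monoˡ-≤ (count t i ^ h) (^-monoʳ-≤ 2 jh≤d) ⟩
        2 ^ d * count t i ^ h        ≡⟨ *-comm (2 ^ d) (count t i ^ h) ⟩
        count t i ^ h * 2 ^ d        ≤⟨ by-offset offset ⟩
        K * suc Z ^ h                ≤⟨ *-monoˡ-≤ (suc Z ^ h) (m≤m^[1+n] h-1 K≥1) ⟩
        K ^ h * suc Z ^ h            ≡⟨ ^-distribʳ-* K (suc Z) h ⟨
        (K * suc Z) ^ h              ∎)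
        where
        open ≤-Reasoning
        by-offset : Offset t d → count t i ^ h * 2 ^ d ≤ K * suc Z ^ h
        by-offset (inj₁ below) = count-below 1≤t 1≤i i≤h below
        by-offset (inj₂ above) = count-above 1≤t 1≤i i≤h above

      level : ℕ → ℕ
      level t = sumTo h (count t)

      C : ℕ
      C = h * (K * suc Z)

      level-decay : ∀ {t d} j → 1 ≤ t → Offset t d → j * h ≤ d → 2 ^ j * level t ≤ C
      level-decay {t} j 1≤t offset jh≤d = subst (_≤ C) (sym (*-distribˡ-sumTo (2 ^ j) h (count t)))
        (sumTo-≤-* h (K * suc Z) (λ i 1≤i i≤h → count-decay j 1≤t 1≤i i≤h offset jh≤d))

      sumTo-level : ∀ T → sumTo T level ≤ 2 * h * C + 2 * h * C
      sumTo-level T = begin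
        sumTo T level                                                   ≤⟨ sumTo-monoˡ-≤ level (m≤n+m T u) ⟩
        sumTo (u + T) level                                             ≡⟨ sumTo-split u T level ⟩
        sumTo u level + sumTo T (λ e → level (u + e))                   ≡⟨ cong (_+ sumTo T (λ e → level (u + e))) (sumTo-reverse u level) ⟩
        sumTo u (λ e → level (suc u ∸ e)) + sumTo T (λ e → level (u + e))
          ≤⟨ +-mono-≤ (sumTo-halving u (λ e → level (suc u ∸ e)) (s≤s z≤n) below)
                        (sumTo-halving T (λ e → level (u + e)) (s≤s z≤n) above) ⟩
        2 * h * C + 2 * h * C                                           ∎
        where
        open ≤-Reasoning
        below : HalvesEvery h C u (λ e → level (suc u ∸ e))
        below d j jh≤d d<u = level-decay j (m<n⇒0<n∸m d<u) (inj₁ (m∸n+n≡m (<⇒≤ d<u))) jh≤d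
        above : HalvesEvery h C T (λ e → level (u + e))
        above d j jh≤d _ = level-decay j (≤-trans (s≤s z≤n) (≤-reflexive (sym (+-suc u d)))) (inj₂ (+-suc u d)) jh≤d

      T : ℕ
      T = W * x ^ h

      level-list : ℕ → List ℕ
      level-list t = concatTo h (λ i → multiples (a′ i (m t)) (count t i))

      candidates : List ℕ
      candidates = multiples 1 (h-1 * Q) ++ concatTo T level-list

      length-candidates : length candidates ≡ h-1 * Q + sumTo T level
      length-candidates = begin
        length candidates                                           ≡⟨ length-++ (multiples 1 (h-1 * Q)) ⟩
        length (multiples 1 (h-1 * Q)) + length (concatTo T level-list)
          ≡⟨ cong₂ _+_ (length-multiples 1 (h-1 * Q)) (length-concatTo T level-list) ⟩
        h-1 * Q + sumTo T (λ t → length (level-list t))             ≡⟨ cong (h-1 * Q +_) (sumTo-cong T length-level) ⟩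
        h-1 * Q + sumTo T level                                     ∎
        where
        open ≡-Reasoning
        length-level : Upto T (λ t → length (level-list t) ≡ level t)
        length-level t _ _ = trans (length-concatTo h _) (sumTo-cong h (λ i _ _ → length-multiples (a′ i (m t)) (count t i)))

      ∈-candidates : ∀ {y} → 1 ≤ y → y ≤ x → 𝒜 y → y ∈ candidates
      ∈-candidates {y} 1≤y _ (inj₁ y≤[h-1]Q) =
        ++⁺ˡ (subst (_∈ multiples 1 (h-1 * Q)) (*-identityˡ y) (∈-multiples 1 (h-1 * Q) 1≤y y≤[h-1]Q))
      ∈-candidates 1≤y y≤x (inj₂ (t , i , v , 1≤t , 1≤i , i≤h , 1≤v , av≤bound , refl)) =
        ++⁺ʳ (multiples 1 (h-1 * Q))
          (∈-concatTo T level-list 1≤t t≤T (∈-concatTo h _ 1≤i i≤h (∈-multiples (a′ i (m t)) (count t i) 1≤v v≤count)))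
        where
        v≤count : v ≤ count t i
        v≤count = ≤-count (⊓-glb y≤x av≤bound)
        t≤T : t ≤ T
        t≤T = ≤-trans (t≤W*a^h 1≤t 1≤i i≤h) (*-monoʳ-≤ W (^-monoˡ-≤ h (≤-trans (m≤m*n⁺ (a′ i (m t)) 1≤v) y≤x)))

      length^h≤[2E]^h*x : ∀ L → Unique L → All (λ y → 1 ≤ y × y ≤ x × 𝒜 y) L → length L ^ h ≤ (2 * E) ^ h * x
      length^h≤[2E]^h*x L unique members = begin
        length L ^ h           ≤⟨ ^-monoˡ-≤ h length≤ ⟩
        (2 * E * Z) ^ h        ≡⟨ ^-distribʳ-* (2 * E) Z h ⟩
        (2 * E) ^ h * Z ^ h    ≤⟨ *-monoʳ-≤ ((2 * E) ^ h) Z^h≤x ⟩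
        (2 * E) ^ h * x        ∎
        where
        open ≤-Reasoning
        regroup : ∀ a h K z → a * z + (2 * h * (h * (K * z)) + 2 * h * (h * (K * z))) ≡ (a + 4 * (h * (h * K))) * z
        regroup = solve-∀
        length≤ : length L ≤ 2 * E * Z
        length≤ = begin
          length L                           ≤⟨ Unique-⊆⇒length-≤ L candidates unique (λ y∈L → ∈-of-members (lookup members y∈L)) ⟩
          length candidates                  ≡⟨ length-candidates ⟩
          h-1 * Q + sumTo T level            ≤⟨ +-mono-≤ (m≤m*n (h-1 * Q) (suc Z)) (sumTo-level T) ⟩
          h-1 * Q * suc Z + (2 * h * C + 2 * h * C) ≡⟨ regroup (h-1 * Q) h K (suc Z) ⟩
          E * suc Z                          ≤⟨ *-monoʳ-≤ E (≤-trans (≤-reflexive (+-comm 1 Z)) (+-monoʳ-≤ Z (≤-trans (s≤s z≤n) (m≤m+n Z 0)))) ⟩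
          E * (2 * Z)                        ≡⟨ *-assoc E 2 Z ⟨
          E * 2 * Z                          ≡⟨ cong (_* Z) (*-comm E 2) ⟩
          2 * E * Z                          ∎
          where
          ∈-of-members : ∀ {y} → 1 ≤ y × y ≤ x × 𝒜 y → y ∈ candidates
          ∈-of-members (1≤y , y≤x , y∈𝒜) = ∈-candidates 1≤y y≤x y∈𝒜

    thin : Thin h 𝒜
    thin = (2 * E) ^ h , 1 , λ x 1≤x → Counting.length^h≤[2E]^h*x x 1≤x

theorem1 : (h : ℕ) → 2 ≤ h →
    (k₁ : ℕ) → suc k₁ ^ h < 2 * k₁ ^ h →
    (r : ℕ → ℕ) →
    (∀ i → 1 ≤ i → i ≤ h → 1 ≤ r i) →
    (∀ i j → 1 ≤ i → i < j → j ≤ h → r i < r j) →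
    (∀ i j → 1 ≤ i → i < j → j ≤ h → Coprime (r i) (r j)) →
    (P : ℕ) → 1 ≤ P → r h ∸ r 1 ≤ P →
    (∀ i j p → 1 ≤ i → i < j → j ≤ h → Prime p → p ∣ (r j ∸ r i) → p ∣ P) →
    (m : ℕ → ℕ) →
    (∀ t → 1 ≤ t → S h P r (m t) ≤ S h P r k₁ ^ t × S h P r k₁ ^ t < S h P r (suc (m t))) →
    IsBasisOfOrder h (InA h P r k₁ m) × Thin h (InA h P r k₁ m)
theorem1 (suc (suc h₀)) _ zero () _ _ _ _ _ _ _ _ _ _
theorem1 (suc zero) (s≤s ()) _ _ _ _ _ _ _ _ _ _ _ _
theorem1 (suc (suc h₀)) _ k₁@(suc _) _ r r-pos r-increasing r-coprime P P-pos P-spread P-primes m m-spec =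
  basis , thin
  where
  open Moduli h₀ P r r-pos r-increasing r-coprime P-pos P-spread P-primes
  open Sequence k₁ (s≤s z≤n) m m-spec
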